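{- Let $X$ be a set, $b\in\mathbb{N}$, $(\varphi_i)_{i\in[1,b]}$ an individual bin evaluation, and $(X_1,\dots,X_\tau)$ a type partition of $X$. Let $X'\subseteq X$ and let $\vec p,\vec q\in\mathbb{N}_0^\tau$ be type specifications such that $|X_j\cap X'|\ge p_j$ and $|X_j\cap(X\setminus X')|\ge q_j$ for all $j\in[1,\tau]$. Then sets $X_{\vec p}\subseteq X'$ containing exactly $p_j$ elements of $X_j\cap X'$ for each $j$, and $X_{\vec q}\subseteq X\setminus X'$ containing exactly $q_j$ elements of $X_j\cap(X\setminus X')$ for each $j$, exist, and for every $i\in[1,b]$ the value $\varphi_i((X'\setminus X_{\vec p})\cup X_{\vec q})$ does not depend on the choice of such sets $X_{\vec p}$ and $X_{\vec q}$.
   Context: For integers $a\le b$, $[a,b]=\{i\in\mathbb{N}: a\le i\le b\}$. Let $\mathrm{inf}\in\{\infty,-\infty\}$. An individual bin evaluation is a $b$-tuple $(\varphi_i)_{i\in[1,b]}$ of functions $\varphi_i:2^X\to\mathbb{Z}\cup\{\mathrm{inf}\}$. Two elements $x,y\in X$ are target equivalent if for every $i\in[1,b]$ and every $A\subseteq X$ with $\{x,y\}\cap A=\{x\}$ we have $\varphi_i((A\setminus\{x\})\cup\{y\})=\varphi_i(A)$. A type partition is a tuple $(X_1,\dots,X_\tau)$ of pairwise disjoint sets with union $X$ such that elements of each $X_j$ are pairwise target equivalent. A type specification is a vector $\vec p=(p_1,\dots,p_\tau)\in\mathbb{N}_0^\tau$ with $p_j\in[0,|X_j|]$ for all $j$.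 -}

module Defs where

open import Data.Nat using (ℕ; _≤_)
open import Data.Integer using (ℤ)
open import Data.Fin using (Fin)
open import Data.Fin.Subset using (Subset; _∈_; _∉_; _⊆_; _∩_; _∪_; _─_; _-_; ∁; ⁅_⁆; ∣_∣; ⊥)
open import Data.Product using (Σ; ∃; _×_; _,_)
open import Relation.Nullary using (¬_)
open import Relation.Binary.PropositionalEquality using (_≡_; _≢_)

-- The codomain ℤ ∪ {inf}; the single extra value `inf` stands for the
-- fixed symbol inf ∈ {∞, -∞}.
data ℤ∪inf : Set where
  fin : ℤ → ℤ∪inf
  inf : ℤ∪inf

IndividualBinEvaluation : ℕ → ℕ → Set
IndividualBinEvaluation n b = Fin b → Subset n → ℤ∪inf

-- x, y target equivalent: for all i and all A with {x,y} ∩ A = {x},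
-- φ_i((A ∖ {x}) ∪ {y}) = φ_i(A).
TargetEquivalent : ∀ {n b} → IndividualBinEvaluation n b → Fin n → Fin n → Set
TargetEquivalent {n} φ x y =
  ∀ i (A : Subset n) → x ∈ A → (y ∈ A → y ≡ x) →
  φ i ((A - x) ∪ ⁅ y ⁆) ≡ φ i A

record TypePartition {n b} (φ : IndividualBinEvaluation n b) (τ : ℕ)
                     (Xs : Fin τ → Subset n) : Set where
  field
    disjoint : ∀ j k → j ≢ k → Xs j ∩ Xs k ≡ ⊥
    covers   : ∀ (x : Fin n) → ∃ λ j → x ∈ Xs j
    targetEq : ∀ j x y → x ∈ Xs j → y ∈ Xs j → TargetEquivalent φ x y

TypeSpecification : ∀ {n τ} → (Fin τ → Subset n) → (Fin τ → ℕ) → Set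
TypeSpecification Xs p = ∀ j → p j ≤ ∣ Xs j ∣

Selects : ∀ {n τ} → (Fin τ → Subset n) → Subset n → (Fin τ → ℕ) → Subset n → Set
Selects Xs Y p P = P ⊆ Y × (∀ j → ∣ Xs j ∩ P ∣ ≡ p j)

{-# OPTIONS --safe #-}
-- Target equivalence within a type means that trading an element x ∈ R for an element
-- y ∉ R of the same type leaves every φ i unchanged, and such a swap also preserves the
-- type counts ∣ Xs j ∩ R ∣. Hence φ i R depends only on these counts: if R and R′ have
-- equal counts and x ∈ R ─ R′, counting inside the type of x yields some y ∈ R′ ─ R of
-- that type, and swapping x for y in R makes R ─ R′ strictly smaller. Every admissible
-- set (X' ─ P) ∪ Q has type counts ∣ Xs j ∩ X' ∣ − p j + q j, and admissible P and Q
-- exist: take, inside each type, the first p j elements of Xs j ∩ X' (resp. the first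
-- q j elements of Xs j ∩ ∁ X').
module Submission where

open import Defs
open import Data.Nat using (ℕ; _≤_)
open import Data.Fin using (Fin)
open import Data.Fin.Subset using (Subset; _∩_; _∪_; _─_; ∁; ∣_∣)
open import Data.Product using (Σ; ∃; _×_; _,_)
open import Relation.Binary.PropositionalEquality using (_≡_)

open import Data.Bool using (true; false)
open import Data.Empty using (⊥-elim)
open import Data.Fin.Properties using (_≟_)
open import Data.Fin.Subset using (_∈_; _∉_; _⊆_; _⊂_; ⁅_⁆; _-_; ⊥; Nonempty; Empty)
open import Data.Fin.Subset.Properties
  using ( _∈?_; nonempty?; ∉⊥; ∣⊥∣≡0; x∈⁅x⁆; x∈⁅y⁆⇒x≡y; ∣⁅x⁆∣≡1; ⊆-antisym; drop-∷-⊆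
        ; p⊂q⇒∣p∣<∣q∣; x∈∁p⇒x∉p; Empty-unique; p∩q⊆p; p∩q⊆q; x∈p∩q⁺; x∈p∩q⁻; ∩-distribˡ-∪
        ; ∪-identityʳ; x∈p∪q⁻; p─⊥≡p; x∈p∧x∉q⇒x∈p─q; p─q⊆p)
open import Data.Nat using (zero; suc; _+_; _<_; s≤s⁻¹)
open import Data.Nat.Properties
  using (+-commutativeSemigroup; +-suc; +-cancelʳ-≡; <-irrefl; <-≤-trans; ≤-refl)
open import Algebra.Properties.CommutativeSemigroup +-commutativeSemigroup using (xy∙z≈xz∙y)
open import Data.Product using (proj₁; proj₂)
open import Data.Sum using (inj₁; inj₂)
open import Data.Vec using ([]; _∷_; here; there; lookup; tabulate)
open import Data.Vec.Properties using (∷-injectiveʳ; []=⇒lookup; lookup⇒[]=; lookup∘tabulate)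
open import Function using (_∘_; _⇔_; mk⇔; Equivalence)
open import Relation.Nullary using (yes; no)
open import Relation.Binary.PropositionalEquality
  using (refl; sym; trans; cong; cong₂; subst; subst₂; module ≡-Reasoning)

open Equivalence using (to; from)

private
  variable
    n : ℕ

x∈p─q⇒x∉q : ∀ {x} (p q : Subset n) → x ∈ p ─ q → x ∉ q
x∈p─q⇒x∉q (true  ∷ p) (true ∷ q) ()        here
x∈p─q⇒x∉q (false ∷ p) (true ∷ q) ()        here
x∈p─q⇒x∉q (_     ∷ p) (_    ∷ q) (there h) (there h′) = x∈p─q⇒x∉q p q h h′

x∈p⇒⁅x⁆⊆p : ∀ {x} {p : Subset n} → x ∈ p → ⁅ x ⁆ ⊆ p
x∈p⇒⁅x⁆⊆p {x = x} {p} x∈p y∈⁅x⁆ = subst (_∈ p) (sym (x∈⁅y⁆⇒x≡y x y∈⁅x⁆)) x∈p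

x∈p⇒p∩⁅x⁆≡⁅x⁆ : ∀ {x} {p : Subset n} → x ∈ p → p ∩ ⁅ x ⁆ ≡ ⁅ x ⁆
x∈p⇒p∩⁅x⁆≡⁅x⁆ {p = p} x∈p =
  ⊆-antisym (p∩q⊆q p _) (λ y∈⁅x⁆ → x∈p∩q⁺ (x∈p⇒⁅x⁆⊆p x∈p y∈⁅x⁆ , y∈⁅x⁆))

x∉p⇒p∩⁅x⁆≡⊥ : ∀ {x} {p : Subset n} → x ∉ p → p ∩ ⁅ x ⁆ ≡ ⊥
x∉p⇒p∩⁅x⁆≡⊥ {x = x} {p} x∉p = Empty-unique λ (y , y∈p∩⁅x⁆) →
  let y∈p , y∈⁅x⁆ = x∈p∩q⁻ p _ y∈p∩⁅x⁆ in
  x∉p (subst (_∈ p) (x∈⁅y⁆⇒x≡y x y∈⁅x⁆) y∈p)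

Empty[p─q]⇒p⊆q : ∀ {p q : Subset n} → Empty (p ─ q) → p ⊆ q
Empty[p─q]⇒p⊆q {q = q} empty {x} x∈p with x ∈? q
... | yes x∈q = x∈q
... | no  x∉q = ⊥-elim (empty (x , x∈p∧x∉q⇒x∈p─q x∈p x∉q))

∣p∣≡∣q∣∧q─p≢∅⇒p─q≢∅ : ∀ {p q : Subset n} → ∣ p ∣ ≡ ∣ q ∣ →
                       Nonempty (q ─ p) → Nonempty (p ─ q)
∣p∣≡∣q∣∧q─p≢∅⇒p─q≢∅ {p = p} {q} ∣p∣≡∣q∣ (y , y∈q─p) with nonempty? (p ─ q)
... | yes p─q≢∅ = p─q≢∅
... | no  p─q≡∅ = ⊥-elim (<-irrefl ∣p∣≡∣q∣ (p⊂q⇒∣p∣<∣q∣ p⊂q))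
  where
  p⊂q : p ⊂ q
  p⊂q = Empty[p─q]⇒p⊆q p─q≡∅ , y , p─q⊆p q p y∈q─p , x∈p─q⇒x∉q q p y∈q─p

∩-distribˡ-─ : ∀ (p q r : Subset n) → p ∩ (q ─ r) ≡ p ∩ q ─ p ∩ r
∩-distribˡ-─ []          []      []      = refl
∩-distribˡ-─ (true  ∷ p) (_ ∷ q) (_ ∷ r) = cong (_ ∷_) (∩-distribˡ-─ p q r)
∩-distribˡ-─ (false ∷ p) (_ ∷ q) (_ ∷ r) = cong (_ ∷_) (∩-distribˡ-─ p q r)

∣p∪q∣≡∣p∣+∣q∣ : ∀ (p q : Subset n) → p ∩ q ≡ ⊥ → ∣ p ∪ q ∣ ≡ ∣ p ∣ + ∣ q ∣
∣p∪q∣≡∣p∣+∣q∣ []          []          _     = refl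
∣p∪q∣≡∣p∣+∣q∣ (true  ∷ p) (true  ∷ q) ()
∣p∪q∣≡∣p∣+∣q∣ (true  ∷ p) (false ∷ q) p∩q≡⊥ = cong suc (∣p∪q∣≡∣p∣+∣q∣ p q (∷-injectiveʳ p∩q≡⊥))
∣p∪q∣≡∣p∣+∣q∣ (false ∷ p) (true  ∷ q) p∩q≡⊥ =
  trans (cong suc (∣p∪q∣≡∣p∣+∣q∣ p q (∷-injectiveʳ p∩q≡⊥))) (sym (+-suc ∣ p ∣ ∣ q ∣))
∣p∪q∣≡∣p∣+∣q∣ (false ∷ p) (false ∷ q) p∩q≡⊥ = ∣p∪q∣≡∣p∣+∣q∣ p q (∷-injectiveʳ p∩q≡⊥)

∣p─q∣+∣q∣≡∣p∣ : ∀ (p q : Subset n) → q ⊆ p → ∣ p ─ q ∣ + ∣ q ∣ ≡ ∣ p ∣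
∣p─q∣+∣q∣≡∣p∣ []          []          _   = refl
∣p─q∣+∣q∣≡∣p∣ (true  ∷ p) (true  ∷ q) q⊆p =
  trans (+-suc ∣ p ─ q ∣ ∣ q ∣) (cong suc (∣p─q∣+∣q∣≡∣p∣ p q (drop-∷-⊆ q⊆p)))
∣p─q∣+∣q∣≡∣p∣ (true  ∷ p) (false ∷ q) q⊆p = cong suc (∣p─q∣+∣q∣≡∣p∣ p q (drop-∷-⊆ q⊆p))
∣p─q∣+∣q∣≡∣p∣ (false ∷ p) (true  ∷ q) q⊆p with q⊆p here
... | ()
∣p─q∣+∣q∣≡∣p∣ (false ∷ p) (false ∷ q) q⊆p = ∣p─q∣+∣q∣≡∣p∣ p q (drop-∷-⊆ q⊆p)

∣p-x∪⁅y⁆∣≡∣p∣ : ∀ {x y} {p : Subset n} → x ∈ p → y ∉ p → ∣ (p - x) ∪ ⁅ y ⁆ ∣ ≡ ∣ p ∣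
∣p-x∪⁅y⁆∣≡∣p∣ {x = x} {y} {p} x∈p y∉p = begin
  ∣ (p - x) ∪ ⁅ y ⁆ ∣  ≡⟨ ∣p∪q∣≡∣p∣+∣q∣ (p - x) ⁅ y ⁆ (x∉p⇒p∩⁅x⁆≡⊥ (y∉p ∘ p─q⊆p p ⁅ x ⁆)) ⟩
  ∣ p - x ∣ + ∣ ⁅ y ⁆ ∣ ≡⟨ cong (∣ p - x ∣ +_) (trans (∣⁅x⁆∣≡1 y) (sym (∣⁅x⁆∣≡1 x))) ⟩
  ∣ p - x ∣ + ∣ ⁅ x ⁆ ∣ ≡⟨ ∣p─q∣+∣q∣≡∣p∣ p ⁅ x ⁆ (x∈p⇒⁅x⁆⊆p x∈p) ⟩
  ∣ p ∣                ∎
  where open ≡-Reasoning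

s∩[p─q∪r]≡s∩p─s∩q∪s∩r : ∀ (s p q r : Subset n) → s ∩ ((p ─ q) ∪ r) ≡ (s ∩ p ─ s ∩ q) ∪ s ∩ r
s∩[p─q∪r]≡s∩p─s∩q∪s∩r s p q r =
  trans (∩-distribˡ-∪ s (p ─ q) r) (cong (_∪ s ∩ r) (∩-distribˡ-─ s p q))

∣s∩[p-x∪⁅y⁆]∣≡∣s∩p∣ : ∀ {x y} (s p : Subset n) → x ∈ p → y ∉ p → x ∈ s ⇔ y ∈ s →
                      ∣ s ∩ ((p - x) ∪ ⁅ y ⁆) ∣ ≡ ∣ s ∩ p ∣
∣s∩[p-x∪⁅y⁆]∣≡∣s∩p∣ {x = x} {y} s p x∈p y∉p x∈s⇔y∈s with x ∈? s
... | yes x∈s = begin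
  ∣ s ∩ ((p - x) ∪ ⁅ y ⁆) ∣             ≡⟨ cong ∣_∣ (s∩[p─q∪r]≡s∩p─s∩q∪s∩r s p ⁅ x ⁆ ⁅ y ⁆) ⟩
  ∣ (s ∩ p ─ s ∩ ⁅ x ⁆) ∪ s ∩ ⁅ y ⁆ ∣ ≡⟨ cong₂ (λ a b → ∣ (s ∩ p ─ a) ∪ b ∣)
                                              (x∈p⇒p∩⁅x⁆≡⁅x⁆ x∈s) (x∈p⇒p∩⁅x⁆≡⁅x⁆ (to x∈s⇔y∈s x∈s)) ⟩
  ∣ (s ∩ p - x) ∪ ⁅ y ⁆ ∣               ≡⟨ ∣p-x∪⁅y⁆∣≡∣p∣ (x∈p∩q⁺ (x∈s , x∈p))
                                                               (y∉p ∘ proj₂ ∘ x∈p∩q⁻ s p) ⟩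
  ∣ s ∩ p ∣                              ∎
  where open ≡-Reasoning
... | no x∉s = begin
  ∣ s ∩ ((p - x) ∪ ⁅ y ⁆) ∣             ≡⟨ cong ∣_∣ (s∩[p─q∪r]≡s∩p─s∩q∪s∩r s p ⁅ x ⁆ ⁅ y ⁆) ⟩
  ∣ (s ∩ p ─ s ∩ ⁅ x ⁆) ∪ s ∩ ⁅ y ⁆ ∣ ≡⟨ cong₂ (λ a b → ∣ (s ∩ p ─ a) ∪ b ∣)
                                              (x∉p⇒p∩⁅x⁆≡⊥ x∉s) (x∉p⇒p∩⁅x⁆≡⊥ (x∉s ∘ from x∈s⇔y∈s)) ⟩
  ∣ (s ∩ p ─ ⊥) ∪ ⊥ ∣                   ≡⟨ cong ∣_∣ (trans (∪-identityʳ _) (p─⊥≡p (s ∩ p))) ⟩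
  ∣ s ∩ p ∣                              ∎
  where open ≡-Reasoning

[p-x∪⁅y⁆]─q⊂p─q : ∀ {x y} (p q : Subset n) → x ∈ p ─ q → y ∈ q → ((p - x) ∪ ⁅ y ⁆) ─ q ⊂ p ─ q
[p-x∪⁅y⁆]─q⊂p─q {x = x} {y} p q x∈p─q y∈q = shrinks , x , x∈p─q , x∉swapped
  where
  shrinks : ((p - x) ∪ ⁅ y ⁆) ─ q ⊆ p ─ q
  shrinks {z} z∈swapped─q with x∈p∪q⁻ (p - x) ⁅ y ⁆ (p─q⊆p _ q z∈swapped─q)
  ... | inj₁ z∈p-x = x∈p∧x∉q⇒x∈p─q (p─q⊆p p ⁅ x ⁆ z∈p-x) (x∈p─q⇒x∉q _ q z∈swapped─q)
  ... | inj₂ z∈⁅y⁆ =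
    ⊥-elim (x∈p─q⇒x∉q _ q z∈swapped─q (subst (_∈ q) (sym (x∈⁅y⁆⇒x≡y y z∈⁅y⁆)) y∈q))
  x∉swapped : x ∉ ((p - x) ∪ ⁅ y ⁆) ─ q
  x∉swapped x∈swapped─q with x∈p∪q⁻ (p - x) ⁅ y ⁆ (p─q⊆p _ q x∈swapped─q)
  ... | inj₁ x∈p-x = x∈p─q⇒x∉q p ⁅ x ⁆ x∈p-x (x∈⁅x⁆ x)
  ... | inj₂ x∈⁅y⁆ = x∈p─q⇒x∉q p q x∈p─q (subst (_∈ q) (sym (x∈⁅y⁆⇒x≡y y x∈⁅y⁆)) y∈q)

∣s∩[p─q∪r]∣+∣s∩q∣≡∣s∩p∣+∣s∩r∣ : ∀ (s p q r : Subset n) → q ⊆ p → r ⊆ ∁ p →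
                               ∣ s ∩ ((p ─ q) ∪ r) ∣ + ∣ s ∩ q ∣ ≡ ∣ s ∩ p ∣ + ∣ s ∩ r ∣
∣s∩[p─q∪r]∣+∣s∩q∣≡∣s∩p∣+∣s∩r∣ s p q r q⊆p r⊆∁p = begin
  ∣ s ∩ ((p ─ q) ∪ r) ∣ + ∣ s ∩ q ∣               ≡⟨ cong (λ a → ∣ a ∣ + ∣ s ∩ q ∣)
                                                           (s∩[p─q∪r]≡s∩p─s∩q∪s∩r s p q r) ⟩
  ∣ (s ∩ p ─ s ∩ q) ∪ s ∩ r ∣ + ∣ s ∩ q ∣         ≡⟨ cong (_+ ∣ s ∩ q ∣)
                                                           (∣p∪q∣≡∣p∣+∣q∣ _ _ disjoint) ⟩
  ∣ s ∩ p ─ s ∩ q ∣ + ∣ s ∩ r ∣ + ∣ s ∩ q ∣       ≡⟨ xy∙z≈xz∙y (∣ s ∩ p ─ s ∩ q ∣) _ _ ⟩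
  ∣ s ∩ p ─ s ∩ q ∣ + ∣ s ∩ q ∣ + ∣ s ∩ r ∣       ≡⟨ cong (_+ ∣ s ∩ r ∣)
                                                           (∣p─q∣+∣q∣≡∣p∣ (s ∩ p) (s ∩ q) s∩q⊆s∩p) ⟩
  ∣ s ∩ p ∣ + ∣ s ∩ r ∣                           ∎
  where
  open ≡-Reasoning
  s∩q⊆s∩p : s ∩ q ⊆ s ∩ p
  s∩q⊆s∩p x∈s∩q = let x∈s , x∈q = x∈p∩q⁻ s q x∈s∩q in x∈p∩q⁺ (x∈s , q⊆p x∈q)
  disjoint : (s ∩ p ─ s ∩ q) ∩ s ∩ r ≡ ⊥
  disjoint = Empty-unique λ (x , x∈[s∩p─s∩q]∩s∩r) →
    let x∈s∩p─s∩q , x∈s∩r = x∈p∩q⁻ (s ∩ p ─ s ∩ q) (s ∩ r) x∈[s∩p─s∩q]∩s∩r in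
    x∈∁p⇒x∉p (r⊆∁p (proj₂ (x∈p∩q⁻ s r x∈s∩r))) (proj₂ (x∈p∩q⁻ s p (p─q⊆p _ _ x∈s∩p─s∩q)))

keepFirst : ℕ → Subset n → Subset n
keepFirst zero    p           = ⊥
keepFirst (suc m) []          = []
keepFirst (suc m) (true  ∷ p) = true ∷ keepFirst m p
keepFirst (suc m) (false ∷ p) = false ∷ keepFirst (suc m) p

keepFirst-⊆ : ∀ m (p : Subset n) → keepFirst m p ⊆ p
keepFirst-⊆ zero    p           x∈⊥       = ⊥-elim (∉⊥ x∈⊥)
keepFirst-⊆ (suc m) (true  ∷ p) here      = here
keepFirst-⊆ (suc m) (true  ∷ p) (there h) = there (keepFirst-⊆ m p h)
keepFirst-⊆ (suc m) (false ∷ p) (there h) = there (keepFirst-⊆ (suc m) p h)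

∣keepFirst∣≡m : ∀ m (p : Subset n) → m ≤ ∣ p ∣ → ∣ keepFirst m p ∣ ≡ m
∣keepFirst∣≡m {n} zero p _ = ∣⊥∣≡0 n
∣keepFirst∣≡m (suc m) (true  ∷ p) m<∣p∣ = cong suc (∣keepFirst∣≡m m p (s≤s⁻¹ m<∣p∣))
∣keepFirst∣≡m (suc m) (false ∷ p) m<∣p∣ = ∣keepFirst∣≡m (suc m) p m<∣p∣

glue : ∀ {τ} → (Fin n → Fin τ) → (Fin τ → Subset n) → Subset n
glue c S = tabulate λ x → lookup (S (c x)) x

∈-glue⁺ : ∀ {τ} (c : Fin n → Fin τ) S {x} → x ∈ S (c x) → x ∈ glue c S
∈-glue⁺ c S {x} x∈S = lookup⇒[]= x _ (trans (lookup∘tabulate _ x) ([]=⇒lookup x∈S))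

∈-glue⁻ : ∀ {τ} (c : Fin n → Fin τ) S {x} → x ∈ glue c S → x ∈ S (c x)
∈-glue⁻ c S {x} x∈glue = lookup⇒[]= x _ (trans (sym (lookup∘tabulate _ x)) ([]=⇒lookup x∈glue))

module TypePartitionProperties {n b τ} {φ : IndividualBinEvaluation n b} {Xs : Fin τ → Subset n}
                               (partition : TypePartition φ τ Xs) where
  open TypePartition partition

  type : Fin n → Fin τ
  type x = proj₁ (covers x)

  x∈Xs[type] : ∀ x → x ∈ Xs (type x)
  x∈Xs[type] x = proj₂ (covers x)

  type-unique : ∀ {x j k} → x ∈ Xs j → x ∈ Xs k → j ≡ k
  type-unique {x} {j} {k} x∈Xsj x∈Xsk with j ≟ k
  ... | yes j≡k = j≡k
  ... | no  j≢k = ⊥-elim (∉⊥ (subst (x ∈_) (disjoint j k j≢k) (x∈p∩q⁺ (x∈Xsj , x∈Xsk))))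

  same-type-∈⇔ : ∀ {x y} → y ∈ Xs (type x) → ∀ j → x ∈ Xs j ⇔ y ∈ Xs j
  same-type-∈⇔ {x} {y} y∈Xs[type] j = mk⇔
    (λ x∈Xsj → subst (λ k → y ∈ Xs k) (type-unique (x∈Xs[type] x) x∈Xsj) y∈Xs[type])
    (λ y∈Xsj → subst (λ k → x ∈ Xs k) (type-unique y∈Xs[type] y∈Xsj) (x∈Xs[type] x))

  SameTypeCounts : Subset n → Subset n → Set
  SameTypeCounts R R′ = ∀ j → ∣ Xs j ∩ R ∣ ≡ ∣ Xs j ∩ R′ ∣

  exchange : ∀ {R R′ x} → SameTypeCounts R R′ → x ∈ R ─ R′ →
             ∃ λ y → y ∈ Xs (type x) × y ∈ R′ ─ R
  exchange {R} {R′} {x} same x∈R─R′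
    with ∣p∣≡∣q∣∧q─p≢∅⇒p─q≢∅ (sym (same (type x)))
           (x , subst (x ∈_) (∩-distribˡ-─ _ R R′) (x∈p∩q⁺ (x∈Xs[type] x , x∈R─R′)))
  ... | y , y∈Xs∩R′─Xs∩R =
    y , x∈p∩q⁻ _ (R′ ─ R) (subst (y ∈_) (sym (∩-distribˡ-─ _ R′ R)) y∈Xs∩R′─Xs∩R)

  swap-preserves-φ : ∀ {R x y} → x ∈ R → y ∉ R → y ∈ Xs (type x) →
                     ∀ i → φ i ((R - x) ∪ ⁅ y ⁆) ≡ φ i R
  swap-preserves-φ {R} {x} {y} x∈R y∉R y∈Xs[type] i =
    targetEq (type x) x y (x∈Xs[type] x) y∈Xs[type] i R x∈R (⊥-elim ∘ y∉R)

  swap-preserves-counts : ∀ {R x y} → x ∈ R → y ∉ R → y ∈ Xs (type x) →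
                          SameTypeCounts ((R - x) ∪ ⁅ y ⁆) R
  swap-preserves-counts {R} x∈R y∉R y∈Xs[type] j =
    ∣s∩[p-x∪⁅y⁆]∣≡∣s∩p∣ (Xs j) R x∈R y∉R (same-type-∈⇔ y∈Xs[type] j)

  φ-determined-by-counts : ∀ {R R′} → SameTypeCounts R R′ → ∀ i → φ i R ≡ φ i R′
  φ-determined-by-counts {R} {R′} same i = go (suc ∣ R ─ R′ ∣) ≤-refl same
    where
    go : ∀ k {S} → ∣ S ─ R′ ∣ < k → SameTypeCounts S R′ → φ i S ≡ φ i R′
    go zero    ()
    go (suc k) {S} bound sameS with nonempty? (S ─ R′)
    ... | no S─R′≡∅ = cong (φ i) (⊆-antisym (Empty[p─q]⇒p⊆q S─R′≡∅) (Empty[p─q]⇒p⊆q R′─S≡∅))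
      where
      R′─S≡∅ : Empty (R′ ─ S)
      R′─S≡∅ (y , y∈R′─S) = S─R′≡∅ (_ , proj₂ (proj₂ (exchange (sym ∘ sameS) y∈R′─S)))
    ... | yes (x , x∈S─R′) with exchange sameS x∈S─R′
    ...   | y , y∈Xs[type] , y∈R′─S =
      trans (sym (swap-preserves-φ x∈S y∉S y∈Xs[type] i)) (go k shorter sameSwapped)
      where
      x∈S : x ∈ S
      x∈S = p─q⊆p S R′ x∈S─R′
      y∉S : y ∉ S
      y∉S = x∈p─q⇒x∉q R′ S y∈R′─S
      shorter : ∣ ((S - x) ∪ ⁅ y ⁆) ─ R′ ∣ < k
      shorter = <-≤-trans (p⊂q⇒∣p∣<∣q∣ ([p-x∪⁅y⁆]─q⊂p─q S R′ x∈S─R′ (p─q⊆p R′ S y∈R′─S)))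
                          (s≤s⁻¹ bound)
      sameSwapped : SameTypeCounts ((S - x) ∪ ⁅ y ⁆) R′
      sameSwapped j = trans (swap-preserves-counts x∈S y∉S y∈Xs[type] j) (sameS j)

  ∩-glue : ∀ {S : Fin τ → Subset n} → (∀ j → S j ⊆ Xs j) → ∀ j → Xs j ∩ glue type S ≡ S j
  ∩-glue {S} S⊆Xs j = ⊆-antisym
    (λ {x} x∈Xs∩glue → let x∈Xsj , x∈glue = x∈p∩q⁻ (Xs j) _ x∈Xs∩glue in
      subst (λ k → x ∈ S k) (type-unique (x∈Xs[type] x) x∈Xsj) (∈-glue⁻ type S x∈glue))
    (λ {x} x∈Sj → x∈p∩q⁺ (S⊆Xs j x∈Sj ,
      ∈-glue⁺ type S (subst (λ k → x ∈ S k) (type-unique (S⊆Xs j x∈Sj) (x∈Xs[type] x)) x∈Sj)))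

  select : ∀ Y m → (∀ j → m j ≤ ∣ Xs j ∩ Y ∣) → Σ (Subset n) (Selects Xs Y m)
  select Y m m≤ = glue type S , glue⊆Y , ∣Xs∩glue∣
    where
    S : Fin τ → Subset n
    S j = keepFirst (m j) (Xs j ∩ Y)
    S⊆Xs : ∀ j → S j ⊆ Xs j
    S⊆Xs j = p∩q⊆p (Xs j) Y ∘ keepFirst-⊆ (m j) _
    glue⊆Y : glue type S ⊆ Y
    glue⊆Y {x} = p∩q⊆q (Xs (type x)) Y ∘ keepFirst-⊆ (m (type x)) _ ∘ ∈-glue⁻ type S
    ∣Xs∩glue∣ : ∀ j → ∣ Xs j ∩ glue type S ∣ ≡ m j
    ∣Xs∩glue∣ j = trans (cong ∣_∣ (∩-glue S⊆Xs j)) (∣keepFirst∣≡m (m j) _ (m≤ j))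

proposition8 : (n b : ℕ) (φ : IndividualBinEvaluation n b)
    (τ : ℕ) (Xs : Fin τ → Subset n) → TypePartition φ τ Xs →
    (X' : Subset n) (p q : Fin τ → ℕ) →
    TypeSpecification Xs p → TypeSpecification Xs q →
    (∀ j → p j ≤ ∣ Xs j ∩ X' ∣) → (∀ j → q j ≤ ∣ Xs j ∩ ∁ X' ∣) →
    (Σ (Subset n) λ P → Σ (Subset n) λ Q →
        Selects Xs X' p P × Selects Xs (∁ X') q Q)
    × (∀ P Q P' Q' → Selects Xs X' p P → Selects Xs (∁ X') q Q →
        Selects Xs X' p P' → Selects Xs (∁ X') q Q' →
        ∀ i → φ i ((X' ─ P) ∪ Q) ≡ φ i ((X' ─ P') ∪ Q'))
proposition8 n b φ τ Xs partition X' p q _ _ p≤ q≤ =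
  (proj₁ selectP , proj₁ selectQ , proj₂ selectP , proj₂ selectQ) ,
  λ P Q P' Q' selP selQ selP' selQ' →
    φ-determined-by-counts λ j →
      +-cancelʳ-≡ (p j) _ _ (trans (counts selP selQ j) (sym (counts selP' selQ' j)))
  where
  open TypePartitionProperties partition
  selectP : Σ (Subset n) (Selects Xs X' p)
  selectP = select X' p p≤
  selectQ : Σ (Subset n) (Selects Xs (∁ X') q)
  selectQ = select (∁ X') q q≤
  counts : ∀ {P Q} → Selects Xs X' p P → Selects Xs (∁ X') q Q →
           ∀ j → ∣ Xs j ∩ ((X' ─ P) ∪ Q) ∣ + p j ≡ ∣ Xs j ∩ X' ∣ + q j
  counts {P} {Q} (P⊆X' , ∣P∣) (Q⊆∁X' , ∣Q∣) j =
    subst₂ (λ a c → ∣ Xs j ∩ ((X' ─ P) ∪ Q) ∣ + a ≡ ∣ Xs j ∩ X' ∣ + c) (∣P∣ j) (∣Q∣ j)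
           (∣s∩[p─q∪r]∣+∣s∩q∣≡∣s∩p∣+∣s∩r∣ (Xs j) X' P Q P⊆X' Q⊆∁X')
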